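{- Let $K$ be a finite Eulerian poset with minimum $\hat 0$, let $P\in\mathrm{Or}(K)$ be a projection, and let $A:=P_{\hat 0}\cap\mathrm{atom}(K)$. Then $P_{\hat 0}=K_A$.
   Context: A finite poset $K$ is graded if it has a minimum $\hat 0$, maximum and rank function $\rho$; it is Eulerian if it is graded and $\mu_K(x,y)=(-1)^{\rho(y)-\rho(x)}$ for all $x\leqslant y$. $\mathrm{atom}(K)$ is the set of elements covering $\hat 0$. For $A\subseteq\mathrm{atom}(K)$, $K_A:=\{x\in K:$ for every $a\in\mathrm{atom}(K)$, $a\leqslant x$ implies $a\in A\}$. $\mathrm{Or}(K)$ is the monoid under composition of order preserving regressive ($f(x)\leqslant x$) maps $K\to K$. For $f:K\to K$, $f_y:=\{x:f(x)=y\}$. An idempotent $P\in\mathrm{Or}(K)$ is a projection if for all $x,y\in\mathrm{Im}(P)$ with $x\leqslant y$ the set $[x,y]\cap P_x$ is an interval of $K$. -}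

module Defs where

open import Data.Nat as ℕ using (ℕ; _∸_)
open import Data.Integer as ℤ using (ℤ; 0ℤ; 1ℤ; -1ℤ)
open import Data.Fin using (Fin)
open import Data.Bool using (Bool; T; if_then_else_)
open import Data.List using (List; foldr; map; filter)
open import Data.List.Base using (allFin)
open import Data.Product using (Σ; ∃; ∃-syntax; _×_; _,_)
open import Relation.Binary.PropositionalEquality using (_≡_; _≢_)
open import Relation.Nullary using (¬_)
open import Relation.Nullary.Decidable using (Dec; _×-dec_)
open import Data.Bool.Properties using (T?)
open import Function.Bundles using (_⇔_)

record FinPoset (n : ℕ) : Set where
  field
    le      : Fin n → Fin n → Bool
    refl    : ∀ x → T (le x x)
    antisym : ∀ x y → T (le x y) → T (le y x) → x ≡ y
    trans   : ∀ x y z → T (le x y) → T (le y z) → T (le x z)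

module _ {n : ℕ} (K : FinPoset n) where
  open FinPoset K

  _≤K_ : Fin n → Fin n → Set
  x ≤K y = T (le x y)

  _<K_ : Fin n → Fin n → Set
  x <K y = x ≤K y × x ≢ y

  _⋖_ : Fin n → Fin n → Set
  x ⋖ y = x <K y × ¬ (∃[ z ] (x <K z × z <K y))

  IsMinimum : Fin n → Set
  IsMinimum b = ∀ x → b ≤K x

  IsMaximum : Fin n → Set
  IsMaximum t = ∀ x → x ≤K t

  IsRankFunction : Fin n → (Fin n → ℕ) → Set
  IsRankFunction bot ρ = ρ bot ≡ 0 × (∀ x y → x ⋖ y → ρ y ≡ ℕ.suc (ρ x))

  interval : Fin n → Fin n → List (Fin n)
  interval x y = filter (λ z → T? (le x z) ×-dec T? (le z y)) (allFin n)

  sumℤ : List ℤ → ℤ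
  sumℤ = foldr ℤ._+_ 0ℤ

  IsMobius : (Fin n → Fin n → ℤ) → Set
  IsMobius μ =
    (∀ x → μ x x ≡ 1ℤ) ×
    (∀ x y → ¬ (x ≤K y) → μ x y ≡ 0ℤ) ×
    (∀ x y → x <K y → sumℤ (map (μ x) (interval x y)) ≡ 0ℤ)

  record Graded : Set where
    field
      bot    : Fin n
      top    : Fin n
      ρ      : Fin n → ℕ
      isBot  : IsMinimum bot
      isTop  : IsMaximum top
      isRank : IsRankFunction bot ρ

  -- Eulerian: graded and μ_K(x,y) = (-1)^(ρ y - ρ x) for all x ≤ y
  -- (stated by saying that this function (extended by 0 off the order)
  --  is the Möbius function of K; the Möbius function is unique).
  record Eulerian : Set where
    field
      graded : Graded
    open Graded graded public
    field
      mobius : IsMobius (λ x y → if le x y then -1ℤ ℤ.^ (ρ y ∸ ρ x) else 0ℤ)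

  atom : Fin n → Fin n → Set
  atom bot a = bot ⋖ a

  KA : Fin n → (Fin n → Set) → Fin n → Set
  KA bot A x = ∀ a → atom bot a → a ≤K x → A a

  IsOr : (Fin n → Fin n) → Set
  IsOr f = (∀ x y → x ≤K y → f x ≤K f y) × (∀ x → f x ≤K x)

  Idempotent : (Fin n → Fin n) → Set
  Idempotent f = ∀ x → f (f x) ≡ f x

  InImage : (Fin n → Fin n) → Fin n → Set
  InImage f x = ∃[ w ] f w ≡ x

  IsInterval : (Fin n → Set) → Set
  IsInterval S = ∃[ a ] ∃[ b ] (a ≤K b × (∀ z → S z ⇔ (a ≤K z × z ≤K b)))

  IsProjection : (Fin n → Fin n) → Set
  IsProjection P =
    IsOr P × Idempotent P ×
    (∀ x y → InImage P x → InImage P y → x ≤K y →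
       IsInterval (λ z → (x ≤K z × z ≤K y) × P z ≡ x))

-- If every atom below x and every z < x lies in P_0̂ but
-- y := P x ≠ 0̂, then every z < y lies in P_0̂; as P is a projection,
-- P_0̂ ∩ [0̂,y] is an interval, with top b ≠ y, so [0̂,y) = [0̂,b].  Summing
-- μ(0̂,-) over [0̂,y] and over [0̂,b] forces μ(0̂,y) = 0 unless b = 0̂, which is
-- impossible in an Eulerian poset.  So y is an atom below x, whence y = P y = 0̂.
module Submission where

open import Defs
open import Data.Nat using (ℕ; zero; suc; _∸_)
open import Data.Fin using (Fin; _≟_; punchIn)
open import Data.Product using (_×_)
open import Relation.Binary.PropositionalEquality using (_≡_)
open import Function.Bundles using (_⇔_)

open import Data.Bool using (true; false; if_then_else_)
open import Data.Bool.Properties using (T?)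
import Data.Fin as Fin
open import Data.Fin.Induction using (po-wellFounded)
open import Data.Fin.Properties using (punchInᵢ≢i)
open import Data.Integer using (ℤ; 0ℤ; -1ℤ; _+_; _^_)
import Data.Integer.Properties as ℤ
open import Algebra.Properties.CommutativeMonoid.Sum ℤ.+-0-commutativeMonoid
  using (sum; sum-syntax; sum-remove; sum-cong-≗; sum-replicate-zero; ∑-distrib-+)
open import Data.List using (foldr; map; filter; tabulate)
open import Data.Product using (∃-syntax; _,_; proj₁; proj₂)
open import Function using (_∘_; case_of_)
open import Function.Bundles using (mk⇔; Equivalence)
open import Induction.WellFounded using (WellFounded; Acc; acc)
open import Relation.Binary.PropositionalEquality
  using (_≢_; refl; sym; trans; cong; cong₂; isEquivalence; module ≡-Reasoning)
open import Relation.Binary.Structures using (IsPartialOrder)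
open import Relation.Nullary using (¬_; does; yes; no; contradiction)
open import Relation.Nullary.Decidable using (dec-true; dec-false; does-⇔; _×-dec_)
open import Relation.Unary using (Pred; Decidable)

restrict : ∀ {a p} {A : Set a} {P : Pred A p} → Decidable P → (A → ℤ) → A → ℤ
restrict P? g z = if does (P? z) then g z else 0ℤ

module _ {a p} {A : Set a} {P : Pred A p} (P? : Decidable P) (g : A → ℤ) where

  restrict-∈ : ∀ {z} → P z → restrict P? g z ≡ g z
  restrict-∈ {z} Pz = cong (if_then g z else 0ℤ) (dec-true (P? z) Pz)

  restrict-∉ : ∀ {z} → ¬ P z → restrict P? g z ≡ 0ℤ
  restrict-∉ {z} ¬Pz = cong (if_then g z else 0ℤ) (dec-false (P? z) ¬Pz)

  restrict-⇔ : ∀ {q} {Q : Pred A q} (Q? : Decidable Q) → ∀ {z} → P z ⇔ Q z →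
               restrict P? g z ≡ restrict Q? g z
  restrict-⇔ Q? {z} P⇔Q = cong (if_then g z else 0ℤ) (does-⇔ P⇔Q (P? z) (Q? z))

sum-map-filter-tabulate : ∀ {a p} {A : Set a} {P : Pred A p} (P? : Decidable P) (g : A → ℤ)
                          {m} (f : Fin m → A) →
  foldr _+_ 0ℤ (map g (filter P? (tabulate f))) ≡ ∑[ i < m ] restrict P? g (f i)
sum-map-filter-tabulate P? g {zero} f = refl
sum-map-filter-tabulate P? g {suc m} f with does (P? (f Fin.zero))
... | true  = cong (g (f Fin.zero) +_) (sum-map-filter-tabulate P? g (f ∘ Fin.suc))
... | false = trans (sum-map-filter-tabulate P? g (f ∘ Fin.suc)) (sym (ℤ.+-identityˡ _))

∑-delta : ∀ {m} (j : Fin m) (c : ℤ) → ∑[ i < m ] (if does (i ≟ j) then c else 0ℤ) ≡ c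
∑-delta {suc m} j c = begin
  sum δ                       ≡⟨ sum-remove {i = j} δ ⟩
  δ j + sum (δ ∘ punchIn j)   ≡⟨ cong₂ _+_ (cong (if_then c else 0ℤ) (dec-true (j ≟ j) refl))
                                           (trans (sum-cong-≗ off-j) (sum-replicate-zero m)) ⟩
  c + 0ℤ                      ≡⟨ ℤ.+-identityʳ c ⟩
  c                           ∎
  where
  open ≡-Reasoning
  δ : Fin (suc m) → ℤ
  δ i = if does (i ≟ j) then c else 0ℤ
  off-j : ∀ i → δ (punchIn j i) ≡ 0ℤ
  off-j i = cong (if_then c else 0ℤ) (dec-false (punchIn j i ≟ j) (punchInᵢ≢i j i))

module _ {n} (K : FinPoset n) where
  open FinPoset K renaming (refl to ≤-refl; trans to ≤-trans)

  ≤K-isPartialOrder : IsPartialOrder _≡_ (_≤K_ K)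
  ≤K-isPartialOrder = record
    { isPreorder = record
      { isEquivalence = isEquivalence
      ; reflexive     = λ { {x} refl → ≤-refl x }
      ; trans         = λ {x} {y} {z} → ≤-trans x y z
      }
    ; antisym = λ {x} {y} → antisym x y
    }

  <K-wellFounded : WellFounded (_<K_ K)
  <K-wellFounded = po-wellFounded ≤K-isPartialOrder

  <K-≤K-trans : ∀ {x y z} → _<K_ K x y → _≤K_ K y z → _<K_ K x z
  <K-≤K-trans {x} {y} {z} (x≤y , x≢y) y≤z =
    ≤-trans x y z x≤y y≤z , λ { refl → x≢y (antisym x y x≤y y≤z) }

  between? : (x y : Fin n) → Decidable (λ z → _≤K_ K x z × _≤K_ K z y)
  between? x y z = T? (le x z) ×-dec T? (le z y)

  IsTopOfHalfOpenInterval : (x y b : Fin n) → Set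
  IsTopOfHalfOpenInterval x y b =
    _≤K_ K x b × _<K_ K b y × (∀ z → _≤K_ K x z → _<K_ K z y → _≤K_ K z b)

  mobius-vanishes-over-half-open-top : ∀ {μ} → IsMobius K μ → ∀ {x y b} →
    _<K_ K x b → IsTopOfHalfOpenInterval x y b → μ x y ≡ 0ℤ
  mobius-vanishes-over-half-open-top {μ} (_ , _ , sum-μ≡0) {x} {y} {b} x<b (x≤b , (b≤y , b≢y) , below-y≤b) =
    begin
      μ x y                                               ≡⟨ ℤ.+-identityˡ (μ x y) ⟨
      0ℤ + μ x y                                          ≡⟨ cong₂ _+_ ∑[x,b]≡0 (∑-delta y (μ x y)) ⟨
      ∑[ z < n ] [x,b] z + ∑[ z < n ] δ z                 ≡⟨ ∑-distrib-+ [x,b] δ ⟨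
      ∑[ z < n ] ([x,b] z + δ z)                          ≡⟨ sum-cong-≗ split ⟨
      ∑[ z < n ] restrict (between? x y) (μ x) z          ≡⟨ ∑[x,y]≡0 ⟩
      0ℤ                                                  ∎
    where
    open ≡-Reasoning
    x≤y : _≤K_ K x y
    x≤y = ≤-trans x b y x≤b b≤y

    [x,b] δ : Fin n → ℤ
    [x,b] = restrict (between? x b) (μ x)
    δ z = if does (z ≟ y) then μ x y else 0ℤ

    ∑[x,y]≡0 : ∑[ z < n ] restrict (between? x y) (μ x) z ≡ 0ℤ
    ∑[x,y]≡0 = trans (sym (sum-map-filter-tabulate (between? x y) (μ x) (λ z → z)))
                     (sum-μ≡0 x y (x≤y , λ { refl → proj₂ x<b (antisym x b x≤b b≤y) }))

    ∑[x,b]≡0 : ∑[ z < n ] [x,b] z ≡ 0ℤ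
    ∑[x,b]≡0 = trans (sym (sum-map-filter-tabulate (between? x b) (μ x) (λ z → z))) (sum-μ≡0 x b x<b)

    split : ∀ z → restrict (between? x y) (μ x) z ≡ [x,b] z + (if does (z ≟ y) then μ x y else 0ℤ)
    split z with z ≟ y
    ... | yes refl = begin
      restrict (between? x y) (μ x) y   ≡⟨ restrict-∈ (between? x y) (μ x) (x≤y , ≤-refl y) ⟩
      μ x y                             ≡⟨ ℤ.+-identityˡ (μ x y) ⟨
      0ℤ + μ x y                        ≡⟨ cong (_+ μ x y) (restrict-∉ (between? x b) (μ x) y∉[x,b]) ⟨
      [x,b] y + μ x y                   ∎
      where
      y∉[x,b] : ¬ (_≤K_ K x y × _≤K_ K y b)
      y∉[x,b] (_ , y≤b) = b≢y (antisym b y b≤y y≤b)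
    ... | no z≢y = trans (restrict-⇔ (between? x y) (μ x) (between? x b) (mk⇔
            (λ (x≤z , z≤y) → x≤z , below-y≤b z x≤z (z≤y , z≢y))
            (λ (x≤z , z≤b) → x≤z , ≤-trans z b y z≤b b≤y)))
          (sym (ℤ.+-identityʳ _))

module _ {n} {K : FinPoset n} (E : Eulerian K) where
  open FinPoset K using (le; antisym) renaming (trans to ≤-trans)
  open Eulerian E

  eulerian-mobius≢0 : ∀ {x y} → _≤K_ K x y → (if le x y then -1ℤ ^ (ρ y ∸ ρ x) else 0ℤ) ≢ 0ℤ
  eulerian-mobius≢0 {x} {y} x≤y with le x y | x≤y
  ... | true | _ = λ pow≡0 → case ℤ.i^n≡0⇒i≡0 -1ℤ (ρ y ∸ ρ x) pow≡0 of λ ()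

  half-open-top⇒⋖ : ∀ {x y b} → IsTopOfHalfOpenInterval K x y b → _⋖_ K x y
  half-open-top⇒⋖ {x} {y} {b} top@(x≤b , b<y , below-y≤b) with b ≟ x
  ... | yes refl = b<y , λ (z , (x≤z , x≢z) , z<y) → x≢z (antisym x z x≤z (below-y≤b z x≤z z<y))
  ... | no b≢x   = contradiction
    (mobius-vanishes-over-half-open-top K mobius (x≤b , b≢x ∘ sym) top)
    (eulerian-mobius≢0 (≤-trans x b y x≤b (proj₁ b<y)))

module _ {n} (K : FinPoset n) {bot : Fin n} (isBot : IsMinimum K bot) {P : Fin n → Fin n} where
  open FinPoset K using (antisym) renaming (refl to ≤-refl; trans to ≤-trans)

  P-bot : IsOr K P → P bot ≡ bot
  P-bot (_ , regr) = antisym (P bot) bot (regr bot) (isBot (P bot))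

  P≡bot-downward : IsOr K P → ∀ {x z} → _≤K_ K z x → P x ≡ bot → P z ≡ bot
  P≡bot-downward (mono , _) {x} {z} z≤x refl = antisym (P z) bot (mono z x z≤x) (isBot (P z))

  bot-fibre-top : IsProjection K P → ∀ y → InImage K P y →
    ∃[ b ] (_≤K_ K b y × P b ≡ bot × (∀ z → _≤K_ K z y → P z ≡ bot → _≤K_ K z b))
  bot-fibre-top (isOr , _ , interval) y y∈P with interval bot y (bot , P-bot isOr) y∈P (isBot y)
  ... | a , b , a≤b , z∈I⇔ =
    b , proj₂ (proj₁ b∈I) , proj₂ b∈I ,
    λ z z≤y Pz≡bot → proj₂ (Equivalence.to (z∈I⇔ z) ((isBot z , z≤y) , Pz≡bot))
    where
    b∈I : (_≤K_ K bot b × _≤K_ K b y) × P b ≡ bot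
    b∈I = Equivalence.from (z∈I⇔ b) (a≤b , ≤-refl b)

module _ {n} {K : FinPoset n} (E : Eulerian K) {P : Fin n → Fin n} (isProj : IsProjection K P) where
  open FinPoset K using () renaming (trans to ≤-trans)
  open Eulerian E using (bot; isBot)

  private
    regr : ∀ x → _≤K_ K (P x) x
    regr = proj₂ (proj₁ isProj)

    idem : Idempotent K P
    idem = proj₁ (proj₂ isProj)

  atoms-in-bot-fibre⇒P≡bot : ∀ x → Acc (_<K_ K) x →
    (∀ a → atom K bot a → _≤K_ K a x → P a ≡ bot) → P x ≡ bot
  atoms-in-bot-fibre⇒P≡bot x (acc below) atoms≡bot with P x ≟ bot
  ... | yes Px≡bot = Px≡bot
  ... | no Px≢bot with bot-fibre-top K isBot isProj (P x) (x , refl)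
  ...   | b , b≤Px , Pb≡bot , fibre≤b =
    trans (sym (idem x)) (atoms≡bot (P x) (half-open-top⇒⋖ E top) (regr x))
    where
    below-Px-in-fibre : ∀ z → _≤K_ K bot z → _<K_ K z (P x) → _≤K_ K z b
    below-Px-in-fibre z _ z<Px = fibre≤b z (proj₁ z<Px) (atoms-in-bot-fibre⇒P≡bot z (below z<x)
        λ a a-atom a≤z → atoms≡bot a a-atom (≤-trans a z x a≤z (proj₁ z<x)))
      where
      z<x : _<K_ K z x
      z<x = <K-≤K-trans K z<Px (regr x)

    top : IsTopOfHalfOpenInterval K bot (P x) b
    top = isBot b , (b≤Px , λ { refl → Px≢bot (trans (sym (idem x)) Pb≡bot) }) , below-Px-in-fibre

proposition3p9 : (n : ℕ) (K : FinPoset n) (E : Eulerian K) (P : Fin n → Fin n) →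
    IsProjection K P →
    -- A := P_0̂ ∩ atom(K);  conclusion: P_0̂ = K_A
    ∀ x → (P x ≡ Eulerian.bot E) ⇔
      KA K (Eulerian.bot E) (λ a → atom K (Eulerian.bot E) a × P a ≡ Eulerian.bot E) x
proposition3p9 n K E P isProj x = mk⇔
  (λ Px≡bot a a-atom a≤x → a-atom , P≡bot-downward K isBot (proj₁ isProj) a≤x Px≡bot)
  (λ x∈KA → atoms-in-bot-fibre⇒P≡bot E isProj x (<K-wellFounded K x)
    λ a a-atom a≤x → proj₂ (x∈KA a a-atom a≤x))
  where open Eulerian E using (isBot)
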